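{- Let $G$ be a digraph with an even number $n$ of vertices and $m$ edges, and let $H$ be a Hamiltonian cycle in $G$. Then the edges of $H$ can be partitioned into two $(n/2,\ m/2)$-light paths.
   Context: A simple directed path $P$ in $G$ is $(l,D)$-light if its length (number of edges) is $l$ and the sum of the outdegrees (in $G$) of the inner vertices of $P$ is at most $D$. -}

module Defs where

open import Data.Nat using (ℕ; zero; suc; _+_; _*_; _≤_)
open import Data.Fin using (Fin)
open import Data.Bool using (Bool; true; false; if_then_else_)
open import Data.List using (List; []; _∷_; _++_; length; map; take; allFin)
open import Data.Nat.ListAction using (sum)
open import Data.List.Relation.Unary.All using (All)
open import Data.List.Relation.Unary.Unique.Propositional using (Unique)
open import Data.Product using (_×_; _,_)
open import Relation.Binary.PropositionalEquality using (_≡_)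

-- A digraph on the vertex set Fin n, given by its adjacency relation:
-- adj u v ≡ true  iff  there is an edge u → v.
Digraph : ℕ → Set
Digraph n = Fin n → Fin n → Bool

outdeg : ∀ {n} → Digraph n → Fin n → ℕ
outdeg {n} G v = sum (map (λ w → if G v w then 1 else 0) (allFin n))

edgeCount : ∀ {n} → Digraph n → ℕ
edgeCount {n} G = sum (map (outdeg G) (allFin n))

edgesOf : ∀ {A : Set} → List A → List (A × A)
edgesOf (x ∷ y ∷ zs) = (x , y) ∷ edgesOf (y ∷ zs)
edgesOf _ = []

dropLast : ∀ {A : Set} → List A → List A
dropLast [] = []
dropLast (x ∷ []) = []
dropLast (x ∷ y ∷ zs) = x ∷ dropLast (y ∷ zs)

inner : ∀ {A : Set} → List A → List A
inner [] = []
inner (x ∷ xs) = dropLast xs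

IsEdge : ∀ {n} → Digraph n → Fin n × Fin n → Set
IsEdge G (u , v) = G u v ≡ true

IsPath : ∀ {n} → Digraph n → List (Fin n) → Set
IsPath G vs = Unique vs × All (IsEdge G) (edgesOf vs)

-- (l , D)-light path; D = m/2 is possibly fractional, so the bound
-- "sum ≤ D" is passed as the doubled bound 2D (i.e. 2 * sum ≤ 2D).
IsLightPath₂ : ∀ {n} → Digraph n → ℕ → ℕ → List (Fin n) → Set
IsLightPath₂ G l twoD vs =
  IsPath G vs × length (edgesOf vs) ≡ l × 2 * sum (map (outdeg G) (inner vs)) ≤ twoD

hamEdges : ∀ {A : Set} → List A → List (A × A)
hamEdges c = edgesOf (c ++ take 1 c)

IsHamCycle : ∀ {n} → Digraph n → List (Fin n) → Set
IsHamCycle {n} G c = Unique c × length c ≡ n × All (IsEdge G) (hamEdges c)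

module Submission where

-- Write the cycle as a cyclic sequence H = v₀ … v₂q₋₁ of total outdegree T
-- (T ≤ m since the vertices are distinct).  For a rotation c of H let
-- f(c) be the weight of its first half (its first q vertices).  Cutting c
-- as  x X y Y  with |X| = |Y| = q - 1 yields the two q-edge paths x X y
-- and y Y x, whose inner vertices are X and Y.  The weight of X is below
-- both f(c) and f(rot c), and that of Y is below both complementary
-- values T - f(c) and T - f(rot c).  Since f at rotation 0 and at rotation
-- q add up to T, a discrete intermediate value argument finds a rotation
-- where f(c) and f(rot c) lie on opposite sides of T/2; there both inner
-- weights are at most T/2 ≤ m/2.

open import Defs
open import Data.Nat using (ℕ; zero; suc; pred; _+_; _*_; _≤_; z≤n; _/_)
open import Data.Nat.Properties
  using (≤-trans; ≤-total; suc-injective; +-assoc; +-monoʳ-≤; ≤-reflexive; +-identityʳ; +-monoˡ-≤; +-cancelˡ-≤; +-comm; *-comm; *-monoʳ-≤; m≤m+n; m≤n+m; module ≤-Reasoning)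
open import Data.Nat.DivMod using (m*n/n≡m)
open import Data.Nat.Divisibility using (_∣_; divides)
open import Data.Nat.ListAction using (sum)
open import Data.Nat.ListAction.Properties using (sum-++; sum-↭)
open import Data.Nat.Tactic.RingSolver using (solve-∀)
open import Data.Fin using (Fin)
open import Data.List using (List; []; _∷_; _++_; length; map; take; allFin)
open import Data.List.Properties using (++-assoc; ++-identityʳ; map-++; length-++)
open import Data.List.Relation.Binary.Permutation.Propositional using (_↭_; ↭-refl; ↭-sym; ↭-trans; ↭⇒↭ₛ)
open import Data.List.Relation.Binary.Permutation.Propositional.Properties
  using (++-comm; All-resp-↭; ∈-resp-↭; shift; ↭-length)
import Data.List.Relation.Binary.Permutation.Propositional.Properties as Perm
import Data.List.Relation.Binary.Permutation.Setoid.Properties as PermSetoid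
open import Data.List.Relation.Unary.All using (All)
import Data.List.Relation.Unary.All as All
open import Data.List.Relation.Unary.All.Properties using (++⁻ˡ)
open import Data.List.Relation.Unary.Any using (here; there)
open import Data.List.Relation.Unary.Unique.Propositional using (Unique)
open import Data.List.Relation.Unary.Unique.Propositional.Properties using (take⁺)
open import Data.List.Relation.Unary.AllPairs using (_∷_)
open import Data.List.Membership.Propositional using (_∈_)
open import Data.List.Membership.Propositional.Properties using (∈-∃++; ∈-allFin)
open import Data.Product using (Σ; ∃-syntax; _×_; _,_; proj₁; proj₂)
open import Data.Sum using (_⊎_; inj₁; inj₂)
open import Data.Empty using (⊥-elim)
open import Relation.Binary.PropositionalEquality
  using (_≡_; refl; sym; trans; cong; cong₂; subst; subst₂; setoid; module ≡-Reasoning)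

-- Bounds of the form 2 * s ≤ T express s ≤ T/2 without division.
double : ∀ m → 2 * m ≡ m + m
double m = cong (m +_) (+-identityʳ m)

below-half : ∀ u v {T} → u + v ≡ T → T ≤ 2 * u → 2 * v ≤ T
below-half u v refl T≤2u = begin
  2 * v   ≡⟨ double v ⟩
  v + v   ≤⟨ +-monoˡ-≤ v v≤u ⟩
  u + v   ∎
  where
  open ≤-Reasoning
  v≤u : v ≤ u
  v≤u = +-cancelˡ-≤ u v u (≤-trans T≤2u (≤-reflexive (double u)))

above-half : ∀ u v {T} → u + v ≡ T → 2 * u ≤ T → T ≤ 2 * v
above-half u v refl 2u≤T = begin
  u + v   ≤⟨ +-monoˡ-≤ v u≤v ⟩
  v + v   ≡⟨ sym (double v) ⟩
  2 * v   ∎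
  where
  open ≤-Reasoning
  u≤v : u ≤ v
  u≤v = +-cancelˡ-≤ u u v (≤-trans (≤-reflexive (sym (double u))) 2u≤T)

crossing : ∀ {P Q : ℕ → Set} → (∀ i → P i ⊎ Q i) →
  ∀ k → P 0 → Q (suc k) → ∃[ i ] (P i × Q (suc i))
crossing total zero p q = 0 , p , q
crossing {P} {Q} total (suc k) p q with total 1
... | inj₂ q₁ = 0 , p , q₁
... | inj₁ p₁ with crossing {λ i → P (suc i)} {λ i → Q (suc i)} (λ i → total (suc i)) k p₁ q
...   | i , pᵢ , qᵢ = suc i , pᵢ , qᵢ

Straddles : ℕ → ℕ → ℕ → Set
Straddles T a a′ = (2 * a ≤ T × T ≤ 2 * a′) ⊎ (T ≤ 2 * a × 2 * a′ ≤ T)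

crosses-half : ∀ (f : ℕ → ℕ) T k → f 0 + f (suc k) ≡ T →
  ∃[ i ] Straddles T (f i) (f (suc i))
crosses-half f T k sum≡T with ≤-total (2 * f 0) T
... | inj₁ low with crossing (λ i → ≤-total (2 * f i) T) k low (above-half (f 0) (f (suc k)) sum≡T low)
...   | i , pᵢ , qᵢ = i , inj₁ (pᵢ , qᵢ)
crosses-half f T k sum≡T | inj₂ high
  with crossing (λ i → ≤-total T (2 * f i)) k high (below-half (f 0) (f (suc k)) sum≡T high)
...   | i , pᵢ , qᵢ = i , inj₂ (pᵢ , qᵢ)

straddle-bound : ∀ {s t T} u v u′ v′ → s ≤ u → s ≤ u′ → t ≤ v → t ≤ v′ →
  u + v ≡ T → u′ + v′ ≡ T → Straddles T u u′ → 2 * s ≤ T × 2 * t ≤ T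
straddle-bound u v u′ v′ s≤u _ _ t≤v′ _ uv′ (inj₁ (2u≤T , T≤2u′)) =
  ≤-trans (*-monoʳ-≤ 2 s≤u) 2u≤T , ≤-trans (*-monoʳ-≤ 2 t≤v′) (below-half u′ v′ uv′ T≤2u′)
straddle-bound u v u′ v′ _ s≤u′ t≤v _ uv _ (inj₂ (T≤2u , 2u′≤T)) =
  ≤-trans (*-monoʳ-≤ 2 s≤u′) 2u′≤T , ≤-trans (*-monoʳ-≤ 2 t≤v) (below-half u v uv T≤2u)

module _ {A : Set} where

  rot1 : List A → List A
  rot1 []       = []
  rot1 (x ∷ xs) = xs ++ x ∷ []

  rotate : ℕ → List A → List A
  rotate zero    xs = xs
  rotate (suc i) xs = rotate i (rot1 xs)

  rotate-suc : ∀ i xs → rotate (suc i) xs ≡ rot1 (rotate i xs)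
  rotate-suc zero    xs = refl
  rotate-suc (suc i) xs = rotate-suc i (rot1 xs)

  rotate-++ : ∀ (P Q : List A) → rotate (length P) (P ++ Q) ≡ Q ++ P
  rotate-++ []      Q = sym (++-identityʳ Q)
  rotate-++ (p ∷ P) Q = begin
    rotate (length P) ((P ++ Q) ++ p ∷ [])  ≡⟨ cong (rotate (length P)) (++-assoc P Q (p ∷ [])) ⟩
    rotate (length P) (P ++ Q ++ p ∷ [])    ≡⟨ rotate-++ P (Q ++ p ∷ []) ⟩
    (Q ++ p ∷ []) ++ P                      ≡⟨ ++-assoc Q (p ∷ []) P ⟩
    Q ++ p ∷ P                              ∎
    where open ≡-Reasoning

  rotate-↭ : ∀ i xs → rotate i xs ↭ xs
  rotate-↭ zero    xs       = ↭-refl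
  rotate-↭ (suc i) []       = rotate-↭ i []
  rotate-↭ (suc i) (x ∷ xs) = ↭-trans (rotate-↭ i (xs ++ x ∷ [])) (++-comm xs (x ∷ []))

  take-++-length : ∀ (P Q : List A) → take (length P) (P ++ Q) ≡ P
  take-++-length []      Q = refl
  take-++-length (p ∷ P) Q = cong (p ∷_) (take-++-length P Q)

  length-snoc : ∀ (X : List A) y → length (X ++ y ∷ []) ≡ suc (length X)
  length-snoc X y = trans (length-++ X) (+-comm (length X) 1)

  length-edgesOf : ∀ x (xs : List A) → length (edgesOf (x ∷ xs)) ≡ length xs
  length-edgesOf x []       = refl
  length-edgesOf x (y ∷ xs) = cong suc (length-edgesOf y xs)

  dropLast-snoc : ∀ (X : List A) y → dropLast (X ++ y ∷ []) ≡ X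
  dropLast-snoc []          y = refl
  dropLast-snoc (a ∷ [])    y = refl
  dropLast-snoc (a ∷ b ∷ X) y = cong (a ∷_) (dropLast-snoc (b ∷ X) y)

  edgesOf-join : ∀ x P y (Q : List A) →
    edgesOf (x ∷ P ++ y ∷ Q) ≡ edgesOf (x ∷ P ++ y ∷ []) ++ edgesOf (y ∷ Q)
  edgesOf-join x []      y Q = refl
  edgesOf-join x (p ∷ P) y Q = cong ((x , p) ∷_) (edgesOf-join p P y Q)

  hamEdges-split : ∀ x X y (Y : List A) →
    hamEdges (x ∷ X ++ y ∷ Y) ≡ edgesOf (x ∷ X ++ y ∷ []) ++ edgesOf (y ∷ Y ++ x ∷ [])
  hamEdges-split x X y Y =
    trans (cong (λ z → edgesOf (x ∷ z)) (++-assoc X (y ∷ Y) (x ∷ [])))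
          (edgesOf-join x X y (Y ++ x ∷ []))

  hamEdges-swap : ∀ x X y (Y : List A) → hamEdges (y ∷ Y ++ x ∷ X) ↭ hamEdges (x ∷ X ++ y ∷ Y)
  hamEdges-swap x X y Y =
    subst (_↭ hamEdges (x ∷ X ++ y ∷ Y)) (sym (hamEdges-split y Y x X))
      (subst (edgesOf (y ∷ Y ++ x ∷ []) ++ edgesOf (x ∷ X ++ y ∷ []) ↭_) (sym (hamEdges-split x X y Y))
        (++-comm (edgesOf (y ∷ Y ++ x ∷ [])) (edgesOf (x ∷ X ++ y ∷ []))))

  hamEdges-rotate : ∀ i (xs : List A) → hamEdges (rotate i xs) ↭ hamEdges xs
  hamEdges-rotate zero    xs           = ↭-refl
  hamEdges-rotate (suc i) []           = hamEdges-rotate i []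
  hamEdges-rotate (suc i) (x ∷ [])     = hamEdges-rotate i (x ∷ [])
  hamEdges-rotate (suc i) (x ∷ y ∷ ys) =
    ↭-trans (hamEdges-rotate i (y ∷ ys ++ x ∷ [])) (hamEdges-swap x [] y ys)

  split-length : ∀ k j (c : List A) → length c ≡ k + j →
    Σ (List A) λ P → Σ (List A) λ Q → c ≡ P ++ Q × length P ≡ k × length Q ≡ j
  split-length zero    j c       len = [] , c , refl , refl , len
  split-length (suc k) j []      ()
  split-length (suc k) j (a ∷ c) len with split-length k j c (cong pred len)
  ... | P , Q , refl , lP , lQ = a ∷ P , Q , refl , cong suc lP , lQ

module Weights {A : Set} (w : A → ℕ) where

  weight : List A → ℕ
  weight xs = sum (map w xs)

  weight-++ : ∀ xs ys → weight (xs ++ ys) ≡ weight xs + weight ys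
  weight-++ xs ys = trans (cong sum (map-++ w xs ys)) (sum-++ (map w xs) (map w ys))

  weight-↭ : ∀ {xs ys} → xs ↭ ys → weight xs ≡ weight ys
  weight-↭ p = sum-↭ (Perm.map⁺ w p)

  weight-unique-≤ : ∀ xs ys → Unique xs → (∀ {z} → z ∈ xs → z ∈ ys) → weight xs ≤ weight ys
  weight-unique-≤ []       ys _          _   = z≤n
  weight-unique-≤ (x ∷ xs) ys (x∉ ∷ uxs) sub with ∈-∃++ (sub (here refl))
  ... | ys₁ , ys₂ , refl =
    subst (w x + weight xs ≤_) (sym ys≡) (+-monoʳ-≤ (w x) (weight-unique-≤ xs (ys₁ ++ ys₂) uxs sub′))
    where
    ys≡ : weight (ys₁ ++ x ∷ ys₂) ≡ w x + weight (ys₁ ++ ys₂)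
    ys≡ = weight-↭ (shift x ys₁ ys₂)
    sub′ : ∀ {z} → z ∈ xs → z ∈ ys₁ ++ ys₂
    sub′ z∈xs with ∈-resp-↭ (shift x ys₁ ys₂) (sub (there z∈xs))
    ... | here z≡x = ⊥-elim (All.lookup x∉ z∈xs (sym z≡x))
    ... | there z∈ = z∈

  window : ℕ → List A → ℕ
  window q c = weight (take q c)

  -- A cut of c into two arcs x X y and y Y x of k + 1 edges each whose
  -- inner parts X and Y both weigh at most T/2.
  BalancedCut : ℕ → ℕ → List A → Set
  BalancedCut k T c = Σ A λ x → Σ (List A) λ X → Σ A λ y → Σ (List A) λ Y →
    c ≡ x ∷ X ++ y ∷ Y × length X ≡ k × length Y ≡ k × 2 * weight X ≤ T × 2 * weight Y ≤ T

  weight-halves : ∀ x X y Y → (w x + weight X) + (w y + weight Y) ≡ weight (x ∷ X ++ y ∷ Y)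
  weight-halves x X y Y = begin
    (w x + weight X) + (w y + weight Y)  ≡⟨ +-assoc (w x) (weight X) (w y + weight Y) ⟩
    w x + (weight X + weight (y ∷ Y))    ≡⟨ cong (w x +_) (sym (weight-++ X (y ∷ Y))) ⟩
    weight (x ∷ X ++ y ∷ Y)              ∎
    where open ≡-Reasoning

  window-front : ∀ x X y Y → window (suc (length X)) (x ∷ X ++ y ∷ Y) ≡ w x + weight X
  window-front x X y Y = cong (λ P → w x + weight P) (take-++-length X (y ∷ Y))

  window-rot1 : ∀ x X y Y → window (suc (length X)) (rot1 (x ∷ X ++ y ∷ Y)) ≡ weight X + w y
  window-rot1 x X y Y = begin
    window (suc (length X)) ((X ++ y ∷ Y) ++ x ∷ [])
      ≡⟨ window-cong (sym (length-snoc X y)) (reassoc X) ⟩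
    window (length (X ++ y ∷ [])) ((X ++ y ∷ []) ++ Y ++ x ∷ [])
      ≡⟨ cong weight (take-++-length (X ++ y ∷ []) (Y ++ x ∷ [])) ⟩
    weight (X ++ y ∷ [])
      ≡⟨ trans (weight-++ X (y ∷ [])) (cong (weight X +_) (+-identityʳ (w y))) ⟩
    weight X + w y  ∎
    where
    open ≡-Reasoning
    window-cong : ∀ {q q′ c c′} → q ≡ q′ → c ≡ c′ → window q c ≡ window q′ c′
    window-cong refl refl = refl
    reassoc : ∀ X → (X ++ y ∷ Y) ++ x ∷ [] ≡ (X ++ y ∷ []) ++ Y ++ x ∷ []
    reassoc []      = refl
    reassoc (a ∷ X) = cong (a ∷_) (reassoc X)

  window-opposite : ∀ x X y Y → length X ≡ length Y →
    window (suc (length X)) (rotate (suc (length X)) (x ∷ X ++ y ∷ Y)) ≡ w y + weight Y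
  window-opposite x X y Y lX≡lY =
    trans (cong (window (suc (length X))) (rotate-++ (x ∷ X) (y ∷ Y)))
          (subst (λ l → window (suc l) (y ∷ Y ++ x ∷ X) ≡ w y + weight Y) (sym lX≡lY)
                 (window-front y Y x X))

  cut-at : ∀ k c → length c ≡ suc k + suc k →
    Straddles (weight c) (window (suc k) c) (window (suc k) (rot1 c)) → BalancedCut k (weight c) c
  cut-at k c len straddles with split-length (suc k) (suc k) c len
  ... | x ∷ X , y ∷ Y , refl , refl , lY =
    x , X , y , Y , refl , refl , suc-injective lY ,
    straddle-bound (w x + weight X) (w y + weight Y) (weight X + w y) (weight Y + w x)
                   (m≤n+m (weight X) (w x)) (m≤m+n (weight X) (w y))
                   (m≤n+m (weight Y) (w y)) (m≤m+n (weight Y) (w x))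
                   (weight-halves x X y Y)
                   (trans (rearrange (w x) (weight X) (w y) (weight Y)) (weight-halves x X y Y))
                   (subst₂ (Straddles _) (window-front x X y Y) (window-rot1 x X y Y) straddles)
    where
    rearrange : ∀ a b c d → (b + c) + (d + a) ≡ (a + b) + (c + d)
    rearrange = solve-∀

  opposite-halves : ∀ k H → length H ≡ suc k + suc k →
    window (suc k) H + window (suc k) (rotate (suc k) H) ≡ weight H
  opposite-halves k H len with split-length (suc k) (suc k) H len
  ... | x ∷ X , y ∷ Y , refl , refl , lY =
    trans (cong₂ _+_ (window-front x X y Y) (window-opposite x X y Y (sym (suc-injective lY))))
          (weight-halves x X y Y)

  balanced-cut : ∀ k H → length H ≡ suc k + suc k → ∃[ i ] BalancedCut k (weight H) (rotate i H)
  balanced-cut k H len = i , subst (λ T → BalancedCut k T (rotate i H)) same-weight cut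
    where
    f : ℕ → ℕ
    f i = window (suc k) (rotate i H)
    crossing-point : ∃[ i ] Straddles (weight H) (f i) (f (suc i))
    crossing-point = crosses-half f (weight H) k (opposite-halves k H len)
    i : ℕ
    i = proj₁ crossing-point
    same-weight : weight (rotate i H) ≡ weight H
    same-weight = weight-↭ (rotate-↭ i H)
    cut : BalancedCut k (weight (rotate i H)) (rotate i H)
    cut = cut-at k (rotate i H) (trans (↭-length (rotate-↭ i H)) len)
      (subst₂ (λ T a′ → Straddles T (f i) a′) (sym same-weight) (cong (window (suc k)) (rotate-suc i H))
        (proj₂ crossing-point))

module _ {n : ℕ} (G : Digraph n) where

  open Weights (outdeg G)

  IsCycle : List (Fin n) → Set
  IsCycle c = Unique c × All (IsEdge G) (hamEdges c)

  IsCycle-resp : ∀ {c c′} → c ↭ c′ → hamEdges c ↭ hamEdges c′ → IsCycle c → IsCycle c′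
  IsCycle-resp vs es (unique , edges) =
    PermSetoid.Unique-resp-↭ (setoid (Fin n)) (↭⇒↭ₛ vs) unique , All-resp-↭ es edges

  arc-light : ∀ {D} x X y Y → IsCycle (x ∷ X ++ y ∷ Y) → 2 * weight X ≤ D →
    IsLightPath₂ G (suc (length X)) D (x ∷ X ++ y ∷ [])
  arc-light {D} x X y Y (unique , edges) bound =
    (arc-unique , arc-edges) ,
    trans (length-edgesOf x (X ++ y ∷ [])) (length-snoc X y) ,
    subst (λ Z → 2 * weight Z ≤ D) (sym (dropLast-snoc X y)) bound
    where
    arc : List (Fin n)
    arc = x ∷ X ++ y ∷ []
    arc-prefix : x ∷ X ++ y ∷ Y ≡ arc ++ Y
    arc-prefix = cong (x ∷_) (sym (++-assoc X (y ∷ []) Y))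
    arc-unique : Unique arc
    arc-unique = subst Unique (take-++-length arc Y) (take⁺ (length arc) (subst Unique arc-prefix unique))
    arc-edges : All (IsEdge G) (edgesOf arc)
    arc-edges = ++⁻ˡ (edgesOf arc) (subst (All (IsEdge G)) (hamEdges-split x X y Y) edges)

  balanced-arcs : ∀ {k T D} c → IsCycle c → BalancedCut k T c → T ≤ D →
    Σ (List (Fin n)) λ P₁ → Σ (List (Fin n)) λ P₂ →
      IsLightPath₂ G (suc k) D P₁ × IsLightPath₂ G (suc k) D P₂ × edgesOf P₁ ++ edgesOf P₂ ≡ hamEdges c
  balanced-arcs _ cycle (x , X , y , Y , refl , refl , lY , boundX , boundY) T≤D =
    x ∷ X ++ y ∷ [] , y ∷ Y ++ x ∷ [] ,
    arc-light x X y Y cycle (≤-trans boundX T≤D) ,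
    subst (λ l → IsLightPath₂ G (suc l) _ (y ∷ Y ++ x ∷ [])) lY (arc-light y Y x X swapped (≤-trans boundY T≤D)) ,
    sym (hamEdges-split x X y Y)
    where
    swapped : IsCycle (y ∷ Y ++ x ∷ X)
    swapped = IsCycle-resp (++-comm (x ∷ X) (y ∷ Y)) (↭-sym (hamEdges-swap x X y Y)) cycle

lemma7 : (n : ℕ) → 2 ∣ n → 2 ≤ n → (G : Digraph n) → (H : List (Fin n)) → IsHamCycle G H →
    Σ (List (Fin n)) λ P₁ → Σ (List (Fin n)) λ P₂ →
    IsLightPath₂ G (n / 2) (edgeCount G) P₁ × IsLightPath₂ G (n / 2) (edgeCount G) P₂ ×
    (edgesOf P₁ ++ edgesOf P₂) ↭ hamEdges H
lemma7 .(zero * 2)  (divides zero refl)    ()  G H ham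
lemma7 .(suc k * 2) (divides (suc k) refl) _   G H (unique , len , edges) =
  let (i , cut) = balanced-cut k H even-length
      (P₁ , P₂ , light₁ , light₂ , arcs) = balanced-arcs G (rotate i H) (rotated-cycle i) cut degree-bound
  in P₁ , P₂ , at-half light₁ , at-half light₂ , subst (_↭ hamEdges H) (sym arcs) (hamEdges-rotate i H)
  where
  open Weights (outdeg G)
  at-half : ∀ {P} → IsLightPath₂ G (suc k) (edgeCount G) P → IsLightPath₂ G (suc k * 2 / 2) (edgeCount G) P
  at-half {P} = subst (λ l → IsLightPath₂ G l (edgeCount G) P) (sym (m*n/n≡m (suc k) 2))
  even-length : length H ≡ suc k + suc k
  even-length = trans len (trans (*-comm (suc k) 2) (double (suc k)))
  rotated-cycle : ∀ i → IsCycle G (rotate i H)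
  rotated-cycle i = IsCycle-resp G (↭-sym (rotate-↭ i H)) (↭-sym (hamEdges-rotate i H)) (unique , edges)
  degree-bound : weight H ≤ edgeCount G
  degree-bound = weight-unique-≤ H (allFin _) unique (λ {z} _ → ∈-allFin z)
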